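{- Let $G=(V,E)$ be an unweighted graph with $m$ edges whose shortest cycle has length $\ell\leq 20\log(m)$, and let $s=\lceil 40\log(m)/\ell\rceil$. Let $(Y_{e,j})_{e\in E,\,j\in[s]}$ be a $(1/m^{200})$-almost $(\ell s)$-wise independent family of bits with marginals $1/2$, and let $\widetilde{E}=\{e\in E:\ Y_{e,1}=\dots=Y_{e,s}=1\}$ (a $(1/m^{200})$-almost $\ell$-wise independent sample with marginals $p=(1/2)^s$). Then $(V,\widetilde{E})$ is cycle-free with probability at least $1-1/\mathrm{poly}(m)$.
   Context: $\log$ is base 2. A family of bits $(Y_i)$ is $\delta$-almost $k$-wise independent with marginals $1/2$ if for every set $S$ of at most $k$ indices, the total variation distance between the distribution of $(Y_i)_{i\in S}$ and the uniform distribution on $\{0,1\}^S$ is at most $\delta$. "With probability at least $1-1/\mathrm{poly}(m)$" means with probability at least $1-m^{ -c}$ for some absolute constant $c>0$ (for all sufficiently large $m$).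
   Formalization: The joint distribution of the bits $(Y_{e,j})$ takes only rational probabilities. -}

module Defs where

open import Data.Nat as ℕ using (ℕ; zero; suc; _^_)
open import Data.Integer using (+_)
open import Data.Rational as ℚ using (ℚ; 0ℚ; 1ℚ; ½; _/_; ∣_∣)
open import Data.Bool using (Bool; true; false; _∧_)
open import Data.Fin using (Fin; zero; suc; inject₁; fromℕ)
open import Data.List using (List; []; _∷_; length; map; lookup)
open import Data.List.Relation.Unary.Unique.Propositional using (Unique)
open import Data.Product using (Σ; ∃; _×_; _,_; proj₁; proj₂)
open import Data.Sum using (_⊎_)
open import Function.Definitions using (Injective)
open import Relation.Binary.PropositionalEquality using (_≡_; _≢_)
open import Relation.Nullary using (¬_)

record Graph (n m : ℕ) : Set where
  field
    edge      : Fin m → Fin n × Fin n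
    noLoop    : ∀ e → proj₁ (edge e) ≢ proj₂ (edge e)
    simple    : ∀ e f → (edge e ≡ edge f ⊎
                         (proj₁ (edge e) ≡ proj₂ (edge f) × proj₂ (edge e) ≡ proj₁ (edge f)))
                      → e ≡ f
open Graph public

Adj : ∀ {n m} → Graph n m → (Fin m → Bool) → Fin n → Fin n → Set
Adj G keep u v = ∃ λ e → keep e ≡ true ×
  ((proj₁ (edge G e) ≡ u × proj₂ (edge G e) ≡ v) ⊎ (proj₁ (edge G e) ≡ v × proj₂ (edge G e) ≡ u))

CycleOfLength : ∀ {n m} → Graph n m → (Fin m → Bool) → ℕ → Set
CycleOfLength {n} G keep zero = Data.Empty.⊥ where import Data.Empty
CycleOfLength {n} G keep (suc k) =
  3 ℕ.≤ suc k × Σ (Fin (suc k) → Fin n) λ v →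
    Injective _≡_ _≡_ v ×
    (∀ (i : Fin k) → Adj G keep (v (inject₁ i)) (v (suc i))) ×
    Adj G keep (v (fromℕ k)) (v zero)

allEdges : ∀ {m} → Fin m → Bool
allEdges _ = true

Girth : ∀ {n m} → Graph n m → ℕ → Set
Girth G ℓ = CycleOfLength G allEdges ℓ × (∀ k → k ℕ.< ℓ → ¬ CycleOfLength G allEdges k)

CycleFree : ∀ {n m} → Graph n m → (Fin m → Bool) → Set
CycleFree G keep = ∀ k → ¬ CycleOfLength G keep k

-- Finite probability distributions (finite support, rational weights)
-- on outcomes Y : Fin m → Fin s → Bool (the bits Y_{e,j}).

Outcome : ℕ → ℕ → Set
Outcome m s = Fin m → Fin s → Bool

Dist : ℕ → ℕ → Set
Dist m s = List (ℚ × Outcome m s)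

sumℚ : List ℚ → ℚ
sumℚ [] = 0ℚ
sumℚ (x ∷ xs) = x ℚ.+ sumℚ xs

data AllNonNeg : List ℚ → Set where
  []  : AllNonNeg []
  _∷_ : ∀ {x xs} → 0ℚ ℚ.≤ x → AllNonNeg xs → AllNonNeg (x ∷ xs)

IsDist : ∀ {m s} → Dist m s → Set
IsDist D = AllNonNeg (map proj₁ D) × sumℚ (map proj₁ D) ≡ 1ℚ

eqBits : List Bool → List Bool → Bool
eqBits [] [] = true
eqBits (true ∷ xs) (true ∷ ys) = eqBits xs ys
eqBits (false ∷ xs) (false ∷ ys) = eqBits xs ys
eqBits _ _ = false

allBits : ℕ → List (List Bool)
allBits zero = [] ∷ []
allBits (suc k) = Data.List._++_ (map (true ∷_) (allBits k)) (map (false ∷_) (allBits k))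
  where import Data.List

restrict : ∀ {m s} → List (Fin m × Fin s) → Outcome m s → List Bool
restrict S Y = map (λ p → Y (proj₁ p) (proj₂ p)) S

probEq : ∀ {m s} → Dist m s → List (Fin m × Fin s) → List Bool → ℚ
probEq [] S z = 0ℚ
probEq ((w , Y) ∷ D) S z with eqBits (restrict S Y) z
... | true  = w ℚ.+ probEq D S z
... | false = probEq D S z

half^ : ℕ → ℚ
half^ zero = 1ℚ
half^ (suc k) = ½ ℚ.* half^ k

tvUniform : ∀ {m s} → Dist m s → List (Fin m × Fin s) → ℚ
tvUniform D S = ½ ℚ.* sumℚ (map (λ z → ∣ probEq D S z ℚ.- half^ (length S) ∣) (allBits (length S)))

ℕtoℚ : ℕ → ℚ
ℕtoℚ k = + k / 1

-- δ-almost k-wise independent with marginals 1/2, for δ = 1/M (M = m^200):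
-- every set S of at most k indices has TV distance ≤ 1/M, written TV · M ≤ 1.
AlmostKWiseInv : ∀ {m s} → Dist m s → (M k : ℕ) → Set
AlmostKWiseInv {m} {s} D M k =
  ∀ (S : List (Fin m × Fin s)) → Unique S → length S ℕ.≤ k →
    tvUniform D S ℚ.* ℕtoℚ M ℚ.≤ 1ℚ

andAll : (s : ℕ) → (Fin s → Bool) → Bool
andAll zero f = true
andAll (suc s) f = f zero ∧ andAll s (λ j → f (suc j))

sampled : ∀ {m s} → Outcome m s → Fin m → Bool
sampled {s = s} Y e = andAll s (Y e)

selWeight : ∀ {m s} → (D : Dist m s) → (Fin (length D) → Bool) → ℚ
selWeight [] B = 0ℚ
selWeight ((w , _) ∷ D) B with B zero
... | true  = w ℚ.+ selWeight D (λ i → B (suc i))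
... | false = selWeight D (λ i → B (suc i))

powℚ : ℚ → ℕ → ℚ
powℚ q zero = 1ℚ
powℚ q (suc k) = q ℚ.* powℚ q k

-- Pr_D[(V, Ẽ) is not cycle-free] ≤ m^(-a/b): the bad event is covered by a
-- set B of support points with total weight w satisfying w^b · m^a ≤ 1.
FailProbAtMost : ∀ {n m s} → Graph n m → Dist m s → (a b : ℕ) → Set
FailProbAtMost {m = m} G D a b =
  Σ (Fin (length D) → Bool) λ B →
    (∀ i → B i ≡ false → CycleFree G (sampled (proj₂ (lookup D i)))) ×
    powℚ (selWeight D B) b ℚ.* ℕtoℚ (m ^ a) ℚ.≤ 1ℚ

-- A cycle of the sampled graph is a cycle of G, so it has at least ℓ edges and contains a path
-- with h = ⌊(ℓ - 1)/2⌋ ≥ 1 edges, all of them sampled.  Since 2h < ℓ, two different paths with h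
-- edges and the same endpoints would close up into a cycle shorter than the girth; hence such a
-- path is determined by its endpoints, which are ends of edges, and there are at most (2m)²
-- candidates.  A fixed candidate is sampled iff its h·s ≤ ℓ·s bits are all one, which by almost
-- independence has probability at most 2^(-hs) + 2/m^200 ≤ 3·2^(-hs), because 2^(hs) ≤ m^200.
-- Minimality of s and ℓ ≤ 4h give 2^(hs) ≥ m^10, so the union bound yields a failure probability
-- of at most 12m²/m^10 ≤ m^(-7).

module Submission where

open import Defs
open import Data.Nat using (ℕ)

module ListFacts where

  open import Data.Nat using (zero; suc; _+_; _*_; _≤_; z≤n; s≤s)
  open import Data.Fin using (Fin; zero; suc; inject₁; fromℕ)
  open import Data.List using (List; []; _∷_; _++_; [_]; _∷ʳ_; length; map; lookup; reverse;
    tabulate; take; cartesianProduct; cartesianProductWith)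
  open import Data.List.Properties using (length-++; length-map; ++-assoc; unfold-reverse; take++drop≡id)
  open import Data.List.Relation.Unary.All as All using (All; []; _∷_)
  import Data.List.Relation.Unary.All.Properties as All
  open import Data.List.Relation.Unary.Any using (Any; here; there)
  import Data.List.Relation.Unary.First as First
  open import Data.List.Relation.Unary.First.Properties using (toView)
  open import Data.List.Relation.Unary.Linked using (Linked; []; [-]; _∷_)
  open import Data.List.Relation.Unary.Unique.Propositional using (Unique; []; _∷_)
  open import Data.List.Membership.Propositional using (_∈_; _∉_)
  open import Data.List.Membership.Propositional.Properties using (∈-lookup; ∈-cartesianProductWith⁺)
  import Data.List.Membership.DecPropositional as DecMembership
  open import Data.List.Relation.Binary.Permutation.Setoid.Properties as Perm using ()
  open import Data.Empty using (⊥-elim)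
  open import Data.Product using (Σ; _×_; _,_)
  open import Data.Sum using (inj₁; inj₂; swap)
  open import Relation.Binary.Definitions using (DecidableEquality)
  open import Relation.Binary.PropositionalEquality hiding ([_])
  open import Relation.Nullary.Decidable using (toSum)

  module _ {A : Set} where

    lastOr : A → List A → A
    lastOr x []       = x
    lastOr _ (y ∷ ys) = lastOr y ys

    lastOr-∈ : ∀ x xs → lastOr x xs ∈ x ∷ xs
    lastOr-∈ x []       = here refl
    lastOr-∈ _ (y ∷ ys) = there (lastOr-∈ y ys)

    Unique-++⁻ˡ : ∀ (xs : List A) {ys} → Unique (xs ++ ys) → Unique xs
    Unique-++⁻ˡ []       _               = []
    Unique-++⁻ˡ (x ∷ xs) {ys} (x∉ ∷ xs!) = All.++⁻ˡ xs {ys} x∉ ∷ Unique-++⁻ˡ xs xs!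

    Unique-reverse : ∀ {xs : List A} → Unique xs → Unique (reverse xs)
    Unique-reverse {xs} = Perm.Unique-resp-↭ (setoid A) (↭-sym (Perm.↭-reverse (setoid A) xs))
      where open import Data.List.Relation.Binary.Permutation.Setoid (setoid A) using (↭-sym)

    Unique⇒lookup-injective : ∀ {xs : List A} → Unique xs → ∀ {i j} → lookup xs i ≡ lookup xs j → i ≡ j
    Unique⇒lookup-injective (_  ∷ _)   {zero}  {zero}  _  = refl
    Unique⇒lookup-injective (x∉ ∷ _)   {zero}  {suc j} eq = ⊥-elim (All.lookup x∉ (∈-lookup j) eq)
    Unique⇒lookup-injective (x∉ ∷ _)   {suc i} {zero}  eq = ⊥-elim (All.lookup x∉ (∈-lookup i) (sym eq))
    Unique⇒lookup-injective (_  ∷ xs!) {suc i} {suc j} eq = cong suc (Unique⇒lookup-injective xs! eq)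

    module _ (_≟_ : DecidableEquality A) where

      open DecMembership _≟_ using (_∈?_)

      splitAtFirstIn : ∀ xs ys → Any (_∈ ys) xs →
        Σ (List A) λ as → Σ A λ z → Σ (List A) λ rs → xs ≡ as ++ z ∷ rs × All (_∉ ys) as × z ∈ ys
      splitAtFirstIn xs ys common with First.first (λ x → swap (toSum (x ∈? ys))) xs
      ... | inj₂ none  = ⊥-elim (All.All¬⇒¬Any none common)
      ... | inj₁ found with toView found
      ...   | First._++_∷_ {as} as∉ys z∈ys rs = as , _ , rs , refl , as∉ys , z∈ys

    length-++-∷ : ∀ (as : List A) z rs → suc (length as) ≤ length (as ++ z ∷ rs)
    length-++-∷ []       z rs = s≤s z≤n
    length-++-∷ (_ ∷ as) z rs = s≤s (length-++-∷ as z rs)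

    distinct-heads⇒nonempty-prefix : ∀ {x y z : A} {P Q rs rs′} as bs →
      x ∷ P ≡ as ++ z ∷ rs → y ∷ Q ≡ bs ++ z ∷ rs′ → x ≢ y → 1 ≤ length as + length bs
    distinct-heads⇒nonempty-prefix []      []      refl refl x≢y = ⊥-elim (x≢y refl)
    distinct-heads⇒nonempty-prefix (_ ∷ _) _       _    _    _   = s≤s z≤n
    distinct-heads⇒nonempty-prefix []      (_ ∷ _) _    _    _   = s≤s z≤n

    module _ {R : A → A → Set} where

      Linked-++⁻ˡ : ∀ xs {ys} → Linked R (xs ++ ys) → Linked R xs
      Linked-++⁻ˡ []           _         = []
      Linked-++⁻ˡ (x ∷ [])     _         = [-]
      Linked-++⁻ˡ (x ∷ y ∷ xs) (r ∷ rs) = r ∷ Linked-++⁻ˡ (y ∷ xs) rs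

      Linked-take : ∀ k {xs} → Linked R xs → Linked R (take k xs)
      Linked-take k {xs} xs~ = Linked-++⁻ˡ (take k xs) (subst (Linked R) (sym (take++drop≡id k xs)) xs~)

      Linked-join : ∀ xs {y ys} → Linked R (xs ∷ʳ y) → Linked R (y ∷ ys) → Linked R (xs ++ y ∷ ys)
      Linked-join []           _        l = l
      Linked-join (x ∷ [])     (r ∷ _)  l = r ∷ l
      Linked-join (x ∷ y ∷ xs) (r ∷ rs) l = r ∷ Linked-join (y ∷ xs) rs l

      Linked-reverse : (∀ {x y} → R x y → R y x) → ∀ {xs} → Linked R xs → Linked R (reverse xs)
      Linked-reverse R-sym {[]}         []       = []
      Linked-reverse R-sym {x ∷ []}     [-]      = [-]
      Linked-reverse R-sym {x ∷ y ∷ xs} (r ∷ rs) =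
        subst (Linked R) (sym reverse-xyxs)
          (Linked-join (reverse xs) (subst (Linked R) (unfold-reverse y xs) (Linked-reverse R-sym rs)) (R-sym r ∷ [-]))
        where
          reverse-xyxs : reverse (x ∷ y ∷ xs) ≡ reverse xs ++ y ∷ [ x ]
          reverse-xyxs = trans (unfold-reverse x (y ∷ xs))
                           (trans (cong (_∷ʳ x) (unfold-reverse y xs)) (++-assoc (reverse xs) [ y ] [ x ]))

      Linked-tabulate : ∀ {k} (v : Fin (suc k) → A) → (∀ i → R (v (inject₁ i)) (v (suc i))) → Linked R (tabulate v)
      Linked-tabulate {zero}  v r = [-]
      Linked-tabulate {suc k} v r = r zero ∷ Linked-tabulate (λ i → v (suc i)) (λ i → r (suc i))

      Linked-lookup : ∀ x cs {w} → Linked R (x ∷ cs ∷ʳ w) →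
        (∀ i → R (lookup (x ∷ cs) (inject₁ i)) (lookup cs i)) × R (lookup (x ∷ cs) (fromℕ (length cs))) w
      Linked-lookup x []       (r ∷ _)  = (λ ()) , r
      Linked-lookup x (y ∷ cs) (r ∷ rs) with Linked-lookup y cs rs
      ... | steps , closing = (λ { zero → r ; (suc i) → steps i }) , closing

    listsOfLength : List A → ℕ → List (List A)
    listsOfLength xs zero    = [ [] ]
    listsOfLength xs (suc k) = cartesianProductWith _∷_ xs (listsOfLength xs k)

    ∈-listsOfLength : ∀ {xs ys} → All (_∈ xs) ys → ys ∈ listsOfLength xs (length ys)
    ∈-listsOfLength []         = here refl
    ∈-listsOfLength (y∈ ∷ ys∈) = ∈-cartesianProductWith⁺ _∷_ y∈ (∈-listsOfLength ys∈)

  length-cartesianProduct : ∀ {A B : Set} (xs : List A) (ys : List B) →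
    length (cartesianProduct xs ys) ≡ length xs * length ys
  length-cartesianProduct []       ys = refl
  length-cartesianProduct (x ∷ xs) ys =
    trans (length-++ (map (x ,_) ys)) (cong₂ _+_ (length-map (x ,_) ys) (length-cartesianProduct xs ys))

module RationalArithmetic where

  open import Algebra.Bundles using (CommutativeMonoid)
  open import Data.Nat as ℕ using (ℕ; zero; suc; z≤n)
  open import Data.Nat.Coprimality as Coprime using (1-coprimeTo)
  open import Data.Integer as ℤ using (+_)
  import Data.Integer.Properties as ℤP
  open import Data.Rational using (mkℚ; _/_; 0ℚ; 1ℚ; ½; _+_; _*_; _≤_; _<_; ∣_∣; *≤*; positive; nonNegative)
  open import Data.Rational.Properties
  open import Algebra.Properties.Group +-0-group using (⁻¹-involutive)
  open import Algebra.Properties.CommutativeSemigroup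
    (CommutativeMonoid.commutativeSemigroup *-1-commutativeMonoid) using (interchange; xy∙z≈xz∙y)
  open import Data.List using ([]; _∷_)
  open import Data.List.Relation.Unary.All using (All; []; _∷_)
  open import Data.List.Relation.Unary.Any using (here; there)
  open import Data.List.Membership.Propositional using (_∈_)
  open import Data.Sum using (inj₁; inj₂)
  open import Relation.Binary.PropositionalEquality

  ℕtoℚ≡mkℚ : ∀ k → ℕtoℚ k ≡ mkℚ (+ k) 0 (Coprime.sym (1-coprimeTo k))
  ℕtoℚ≡mkℚ k = normalize-coprime (Coprime.sym (1-coprimeTo k))

  ℕtoℚ-+ : ∀ a b → ℕtoℚ (a ℕ.+ b) ≡ ℕtoℚ a + ℕtoℚ b
  ℕtoℚ-+ a b rewrite ℕtoℚ≡mkℚ a | ℕtoℚ≡mkℚ b | ℤP.*-identityʳ (+ a) | ℤP.*-identityʳ (+ b) = refl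

  ℕtoℚ-* : ∀ a b → ℕtoℚ (a ℕ.* b) ≡ ℕtoℚ a * ℕtoℚ b
  ℕtoℚ-* a b = trans (cong (_/ 1) (ℤP.pos-* a b)) (sym (cong₂ _*_ (ℕtoℚ≡mkℚ a) (ℕtoℚ≡mkℚ b)))

  ℕtoℚ-mono-≤ : ∀ {a b} → a ℕ.≤ b → ℕtoℚ a ≤ ℕtoℚ b
  ℕtoℚ-mono-≤ {a} {b} a≤b rewrite ℕtoℚ≡mkℚ a | ℕtoℚ≡mkℚ b =
    *≤* (subst₂ ℤ._≤_ (sym (ℤP.*-identityʳ (+ a))) (sym (ℤP.*-identityʳ (+ b))) (ℤ.+≤+ a≤b))

  0≤ℕtoℚ : ∀ k → 0ℚ ≤ ℕtoℚ k
  0≤ℕtoℚ k = ℕtoℚ-mono-≤ {0} {k} z≤n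

  half^-*-2^ : ∀ k → half^ k * ℕtoℚ (2 ℕ.^ k) ≡ 1ℚ
  half^-*-2^ zero = refl
  half^-*-2^ (suc k) = begin
    (½ * half^ k) * ℕtoℚ (2 ℕ.* 2 ℕ.^ k)       ≡⟨ cong ((½ * half^ k) *_) (ℕtoℚ-* 2 (2 ℕ.^ k)) ⟩
    (½ * half^ k) * (ℕtoℚ 2 * ℕtoℚ (2 ℕ.^ k))  ≡⟨ interchange ½ (half^ k) (ℕtoℚ 2) _ ⟩
    (½ * ℕtoℚ 2) * (half^ k * ℕtoℚ (2 ℕ.^ k))  ≡⟨⟩
    1ℚ * (half^ k * ℕtoℚ (2 ℕ.^ k))            ≡⟨ cong (1ℚ *_) (half^-*-2^ k) ⟩
    1ℚ * 1ℚ                                   ≡⟨⟩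
    1ℚ                                        ∎
    where open ≡-Reasoning

  p≤∣p∣ : ∀ p → p ≤ ∣ p ∣
  p≤∣p∣ p with ∣p∣≡p∨∣p∣≡-p p
  ... | inj₁ ∣p∣≡p  = ≤-reflexive (sym ∣p∣≡p)
  ... | inj₂ ∣p∣≡-p = ≤-trans p≤0 (0≤∣p∣ p)
    where
      p≤0 : p ≤ 0ℚ
      p≤0 = subst (_≤ 0ℚ) (⁻¹-involutive p) (neg-antimono-≤ (subst (0ℚ ≤_) ∣p∣≡-p (0≤∣p∣ p)))

  p≤q+p : ∀ {p q} → 0ℚ ≤ q → p ≤ q + p
  p≤q+p {p} {q} 0≤q = subst (_≤ q + p) (+-identityˡ p) (+-monoˡ-≤ p 0≤q)

  0≤sumℚ : ∀ {xs} → All (0ℚ ≤_) xs → 0ℚ ≤ sumℚ xs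
  0≤sumℚ []         = ≤-refl
  0≤sumℚ (0≤x ∷ 0≤xs) = +-mono-≤ 0≤x (0≤sumℚ 0≤xs)

  ∈⇒≤sumℚ : ∀ {x xs} → All (0ℚ ≤_) xs → x ∈ xs → x ≤ sumℚ xs
  ∈⇒≤sumℚ {x} {_ ∷ xs} (_ ∷ 0≤xs) (here refl) =
    subst (_≤ x + sumℚ xs) (+-identityʳ x) (+-monoʳ-≤ x (0≤sumℚ 0≤xs))
  ∈⇒≤sumℚ (0≤y ∷ 0≤xs) (there x∈xs) = ≤-trans (∈⇒≤sumℚ 0≤xs x∈xs) (p≤q+p 0≤y)

  p*x≤c∧c*a≤x⇒p*a≤1 : ∀ {p x c a} → p * ℕtoℚ x ≤ ℕtoℚ c → c ℕ.* a ℕ.≤ x → 1 ℕ.≤ x → p * ℕtoℚ a ≤ 1ℚ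
  p*x≤c∧c*a≤x⇒p*a≤1 {p} {x} {c} {a} p·x≤c c·a≤x 1≤x = *-cancelʳ-≤-pos X {{positive 0<X}} (begin
    (p * A) * X     ≡⟨ xy∙z≈xz∙y p A X ⟩
    (p * X) * A     ≤⟨ *-monoʳ-≤-nonNeg A {{nonNegative (0≤ℕtoℚ a)}} p·x≤c ⟩
    ℕtoℚ c * A      ≡⟨ ℕtoℚ-* c a ⟨
    ℕtoℚ (c ℕ.* a)  ≤⟨ ℕtoℚ-mono-≤ c·a≤x ⟩
    X               ≡⟨ *-identityˡ X ⟨
    1ℚ * X          ∎)
    where
      open ≤-Reasoning
      X = ℕtoℚ x
      A = ℕtoℚ a
      0<X : 0ℚ < X
      0<X = <-≤-trans (positive⁻¹ 1ℚ) (ℕtoℚ-mono-≤ 1≤x)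

module Probability {m s : ℕ} where

  open RationalArithmetic
  open import Data.Bool using (Bool; true; false; _∨_)
  open import Data.Bool.ListAction using (any)
  open import Data.Nat as ℕ using (ℕ; zero; suc; _^_)
  open import Data.Rational using (ℚ; 0ℚ; 1ℚ; ½; _+_; _*_; _-_; _≤_; ∣_∣; nonNegative)
  open import Data.Rational.Properties
  open import Algebra.Properties.AbelianGroup +-0-abelianGroup using (xyx⁻¹≈y)
  open import Algebra.Bundles using (CommutativeMonoid)
  open import Algebra.Properties.CommutativeSemigroup
    (CommutativeMonoid.commutativeSemigroup +-0-commutativeMonoid) using (x∙yz≈y∙xz)
  open import Data.Fin using (Fin)
  open import Data.List using (List; []; _∷_; length; map; lookup; replicate)
  open import Data.List.Relation.Unary.All as All using (All; []; _∷_)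
  import Data.List.Relation.Unary.All.Properties as All
  open import Data.List.Membership.Propositional using (_∈_)
  open import Data.List.Relation.Unary.Any using (here)
  open import Data.List.Membership.Propositional.Properties using (∈-++⁺ˡ; ∈-map⁺)
  open import Data.Product using (_×_; _,_; proj₁; proj₂)
  open import Relation.Binary.PropositionalEquality

  Event : Set
  Event = Outcome m s → Bool

  Pr : Dist m s → Event → ℚ
  Pr D E = selWeight D (λ i → E (proj₂ (lookup D i)))

  Pr-never : ∀ D → Pr D (λ _ → false) ≡ 0ℚ
  Pr-never []      = refl
  Pr-never (_ ∷ D) = Pr-never D

  Pr-∨ : ∀ {D} → AllNonNeg (map proj₁ D) → ∀ E F → Pr D (λ Y → E Y ∨ F Y) ≤ Pr D E + Pr D F
  Pr-∨ {[]}          []           E F = ≤-refl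
  Pr-∨ {(w , Y) ∷ D} (0≤w ∷ 0≤D) E F with E Y | F Y | Pr-∨ 0≤D E F
  ... | true  | true  | ih = begin
    w + Pr D (λ Y → E Y ∨ F Y)   ≤⟨ +-monoʳ-≤ w ih ⟩
    w + (Pr D E + Pr D F)        ≡⟨ +-assoc w _ _ ⟨
    (w + Pr D E) + Pr D F        ≤⟨ +-monoʳ-≤ (w + Pr D E) (p≤q+p 0≤w) ⟩
    (w + Pr D E) + (w + Pr D F)  ∎
    where open ≤-Reasoning
  ... | true  | false | ih = ≤-trans (+-monoʳ-≤ w ih) (≤-reflexive (sym (+-assoc w _ _)))
  ... | false | true  | ih = ≤-trans (+-monoʳ-≤ w ih) (≤-reflexive (x∙yz≈y∙xz w (Pr D E) (Pr D F)))
  ... | false | false | ih = ih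

  probEq≡Pr : ∀ D S z → probEq D S z ≡ Pr D (λ Y → eqBits (restrict S Y) z)
  probEq≡Pr []            S z = refl
  probEq≡Pr ((w , Y) ∷ D) S z with eqBits (restrict S Y) z
  ... | true  = cong (w +_) (probEq≡Pr D S z)
  ... | false = probEq≡Pr D S z

  module _ (D : Dist m s) (S : List (Fin m × Fin s)) where

    private
      k = length S
      deviation : List Bool → ℚ
      deviation z = ∣ probEq D S z - half^ k ∣
      0≤deviations : All (0ℚ ≤_) (map deviation (allBits k))
      0≤deviations = All.map⁺ (All.universal (λ z → 0≤∣p∣ (probEq D S z - half^ k)) _)

    0≤tvUniform : 0ℚ ≤ tvUniform D S
    0≤tvUniform = *-monoˡ-≤-nonNeg ½ (0≤sumℚ 0≤deviations)

    probEq≤half^+2tv : ∀ {z} → z ∈ allBits k → probEq D S z ≤ half^ k + ℕtoℚ 2 * tvUniform D S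
    probEq≤half^+2tv {z} z∈ = begin
      probEq D S z                       ≡⟨ xyx⁻¹≈y (half^ k) (probEq D S z) ⟨
      half^ k + probEq D S z - half^ k   ≡⟨ +-assoc (half^ k) _ _ ⟩
      half^ k + (probEq D S z - half^ k) ≤⟨ +-monoʳ-≤ (half^ k) (p≤∣p∣ _) ⟩
      half^ k + deviation z              ≤⟨ +-monoʳ-≤ (half^ k) (∈⇒≤sumℚ 0≤deviations (∈-map⁺ deviation z∈)) ⟩
      half^ k + T                        ≡⟨ cong (half^ k +_) (*-identityˡ T) ⟨
      half^ k + 1ℚ * T                   ≡⟨⟩
      half^ k + (ℕtoℚ 2 * ½) * T         ≡⟨ cong (half^ k +_) (*-assoc (ℕtoℚ 2) ½ T) ⟩
      half^ k + ℕtoℚ 2 * tvUniform D S   ∎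
      where
        open ≤-Reasoning
        T = sumℚ (map deviation (allBits k))

  allTrue∈allBits : ∀ k → replicate k true ∈ allBits k
  allTrue∈allBits zero    = here refl
  allTrue∈allBits (suc k) = ∈-++⁺ˡ (∈-map⁺ (true ∷_) (allTrue∈allBits k))

  allOnes : List (Fin m × Fin s) → Event
  allOnes S Y = eqBits (restrict S Y) (replicate (length S) true)

  allOnes-true : ∀ {Y} S → All (λ b → Y (proj₁ b) (proj₂ b) ≡ true) S → allOnes S Y ≡ true
  allOnes-true []      []           = refl
  allOnes-true (_ ∷ S) (Yb≡1 ∷ ones) rewrite Yb≡1 = allOnes-true S ones

  Pr-allOnes-bound : ∀ D S {M} → tvUniform D S * ℕtoℚ M ≤ 1ℚ → 2 ^ length S ℕ.≤ M →
    Pr D (allOnes S) * ℕtoℚ (2 ^ length S) ≤ ℕtoℚ 3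
  Pr-allOnes-bound D S {M} tv·M≤1 2^k≤M = begin
    Pr D (allOnes S) * X                    ≡⟨ cong (_* X) (probEq≡Pr D S (replicate k true)) ⟨
    probEq D S (replicate k true) * X       ≤⟨ *-monoʳ-≤-nonNeg X {{nonNegative (0≤ℕtoℚ (2 ^ k))}}
                                                 (probEq≤half^+2tv D S (allTrue∈allBits k)) ⟩
    (half^ k + ℕtoℚ 2 * tv) * X             ≡⟨ *-distribʳ-+ X (half^ k) (ℕtoℚ 2 * tv) ⟩
    half^ k * X + (ℕtoℚ 2 * tv) * X         ≡⟨ cong₂ _+_ (half^-*-2^ k) (*-assoc (ℕtoℚ 2) tv X) ⟩
    1ℚ + ℕtoℚ 2 * (tv * X)                  ≤⟨ +-monoʳ-≤ 1ℚ (*-monoˡ-≤-nonNeg (ℕtoℚ 2)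
                                                 (*-monoˡ-≤-nonNeg tv {{nonNegative (0≤tvUniform D S)}} (ℕtoℚ-mono-≤ 2^k≤M))) ⟩
    1ℚ + ℕtoℚ 2 * (tv * ℕtoℚ M)             ≤⟨ +-monoʳ-≤ 1ℚ (*-monoˡ-≤-nonNeg (ℕtoℚ 2) tv·M≤1) ⟩
    1ℚ + ℕtoℚ 2 * 1ℚ                        ≡⟨⟩
    ℕtoℚ 3                                  ∎
    where
      open ≤-Reasoning
      k = length S
      X = ℕtoℚ (2 ^ k)
      tv = tvUniform D S

  Pr-any-bound : ∀ {A : Set} {D} → AllNonNeg (map proj₁ D) → (E : A → Event) {X : ℚ} {c : ℕ} → 0ℚ ≤ X →
    ∀ xs → All (λ x → Pr D (E x) * X ≤ ℕtoℚ c) xs →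
    Pr D (λ Y → any (λ x → E x Y) xs) * X ≤ ℕtoℚ (length xs ℕ.* c)
  Pr-any-bound {D = D} _ E {X} 0≤X [] [] = ≤-reflexive (trans (cong (_* X) (Pr-never D)) (*-zeroˡ X))
  Pr-any-bound {D = D} 0≤D E {X} {c} 0≤X (x ∷ xs) (bx ∷ bxs) = begin
    Pr D (λ Y → E x Y ∨ any-rest Y) * X     ≤⟨ *-monoʳ-≤-nonNeg X {{nonNegative 0≤X}}
                                                 (Pr-∨ 0≤D (E x) any-rest) ⟩
    (Pr D (E x) + Pr D any-rest) * X        ≡⟨ *-distribʳ-+ X (Pr D (E x)) (Pr D any-rest) ⟩
    Pr D (E x) * X + Pr D any-rest * X      ≤⟨ +-mono-≤ bx (Pr-any-bound 0≤D E 0≤X xs bxs) ⟩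
    ℕtoℚ c + ℕtoℚ (length xs ℕ.* c)         ≡⟨ ℕtoℚ-+ c _ ⟨
    ℕtoℚ (length (x ∷ xs) ℕ.* c)            ∎
    where
      open ≤-Reasoning
      any-rest : Event
      any-rest Y = any (λ x → E x Y) xs

module Paths {n m : ℕ} (G : Graph n m) where

  open ListFacts
  open import Data.Bool using (Bool; true; false)
  open import Data.Nat as ℕ using (zero; suc; _+_; _≤_; _<_; s≤s)
  import Data.Nat.Properties as ℕP
  open import Data.Fin using (Fin; zero; suc; _≟_)
  open import Data.List using (List; []; _∷_; _++_; [_]; _∷ʳ_; length; map; lookup; reverse; tabulate; take;
    allFin; cartesianProduct)
  open import Data.List.Properties using (length-++; length-map; length-take; length-tabulate; ++-assoc;
    length-reverse; reverse-++; unfold-reverse; ∷-injective)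
  open import Data.List.Relation.Unary.All as All using (All; []; _∷_)
  import Data.List.Relation.Unary.All.Properties as All
  open import Data.List.Relation.Unary.Any as Any using (Any; here; there)
  import Data.List.Relation.Unary.Any.Properties as Any
  open import Data.List.Relation.Unary.Linked as Linked using (Linked; []; [-]; _∷_)
  open import Data.List.Relation.Unary.Unique.Propositional using (Unique; []; _∷_)
  import Data.List.Relation.Unary.Unique.Propositional.Properties as Unique
  open import Data.List.Membership.Propositional using (_∈_; _∉_; lose)
  open import Data.List.Membership.Propositional.Properties using (∈-map⁺; ∈-map⁻; ∈-++⁺ˡ; ∈-∃++;
    ∈-allFin; ∈-cartesianProduct⁺)
  open import Data.List.Relation.Unary.Unique.DecPropositional (_≟_ {n}) using (unique?)
  open import Data.Maybe using (Maybe; just; nothing)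
  open import Data.Empty using (⊥; ⊥-elim)
  open import Data.Product using (Σ; ∃; _×_; _,_; proj₁; proj₂)
  open import Data.Sum using (_⊎_; inj₁; inj₂)
  open import Data.Unit using (⊤; tt)
  open import Relation.Binary.PropositionalEquality hiding ([_])
  open import Relation.Nullary using (¬_; Dec; yes; no)
  open import Relation.Nullary.Decidable using (_×-dec_; map′)

  Dart : Set
  Dart = Fin m × Bool

  src dst : Dart → Fin n
  src (e , true)  = proj₁ (edge G e)
  src (e , false) = proj₂ (edge G e)
  dst (e , true)  = proj₂ (edge G e)
  dst (e , false) = proj₁ (edge G e)

  Adjacent : Fin n → Fin n → Set
  Adjacent = Adj G allEdges

  Adj-sym : ∀ {keep u w} → Adj G keep u w → Adj G keep w u
  Adj-sym (e , kept , inj₁ ends) = e , kept , inj₂ ends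
  Adj-sym (e , kept , inj₂ ends) = e , kept , inj₁ ends

  Adj⇒dart : ∀ {keep u w} → Adj G keep u w → Σ Dart λ d → keep (proj₁ d) ≡ true × src d ≡ u × dst d ≡ w
  Adj⇒dart (e , kept , inj₁ (p , q)) = (e , true)  , kept , p , q
  Adj⇒dart (e , kept , inj₂ (p , q)) = (e , false) , kept , q , p

  Adj⇒Adjacent : ∀ {keep u w} → Adj G keep u w → Adjacent u w
  Adj⇒Adjacent (e , _ , ends) = e , refl , ends

  subgraph-cycle : ∀ {keep k} → CycleOfLength G keep k → CycleOfLength G allEdges k
  subgraph-cycle {k = suc k} (3≤ , v , v-injective , steps , closing) =
    3≤ , v , v-injective , (λ i → Adj⇒Adjacent (steps i)) , Adj⇒Adjacent closing

  dart-Adjacent : ∀ d → Adjacent (src d) (dst d)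
  dart-Adjacent (e , true)  = e , refl , inj₁ (refl , refl)
  dart-Adjacent (e , false) = e , refl , inj₂ (refl , refl)

  same-ends⇒same-edge : ∀ d d′ → src d ≡ src d′ → dst d ≡ dst d′ → proj₁ d ≡ proj₁ d′
  same-ends⇒same-edge (e , true)  (f , true)  p q = simple G e f (inj₁ (cong₂ _,_ p q))
  same-ends⇒same-edge (e , true)  (f , false) p q = simple G e f (inj₂ (p , q))
  same-ends⇒same-edge (e , false) (f , true)  p q = simple G e f (inj₂ (q , p))
  same-ends⇒same-edge (e , false) (f , false) p q = simple G e f (inj₁ (cong₂ _,_ q p))

  same-edge⇒src-shared : ∀ d d′ → proj₁ d ≡ proj₁ d′ → src d ≡ src d′ ⊎ src d ≡ dst d′
  same-edge⇒src-shared (e , true)  (.e , true)  refl = inj₁ refl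
  same-edge⇒src-shared (e , true)  (.e , false) refl = inj₂ refl
  same-edge⇒src-shared (e , false) (.e , true)  refl = inj₂ refl
  same-edge⇒src-shared (e , false) (.e , false) refl = inj₁ refl

  WalkFrom : Fin n → List Dart → Set
  WalkFrom u []       = ⊤
  WalkFrom u (d ∷ ds) = src d ≡ u × WalkFrom (dst d) ds

  walkFrom? : ∀ u ds → Dec (WalkFrom u ds)
  walkFrom? u []       = yes tt
  walkFrom? u (d ∷ ds) = (src d ≟ u) ×-dec walkFrom? (dst d) ds

  vertices : Fin n → List Dart → List (Fin n)
  vertices u ds = u ∷ map dst ds

  edges : List Dart → List (Fin m)
  edges = map proj₁

  walk-linked : ∀ {u} ds → WalkFrom u ds → Linked Adjacent (vertices u ds)
  walk-linked []       _           = [-]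
  walk-linked (d ∷ ds) (refl , w) = dart-Adjacent d ∷ walk-linked ds w

  walk-∈ : ∀ {u} ds {d} → WalkFrom u ds → d ∈ ds → src d ∈ vertices u ds × dst d ∈ vertices u ds
  walk-∈ (d ∷ ds) (refl , w) (here refl) = here refl , there (here refl)
  walk-∈ (d ∷ ds) (refl , w) (there d∈) with walk-∈ ds w d∈
  ... | src∈ , dst∈ = there src∈ , there dst∈

  path-edges-unique : ∀ {u} ds → WalkFrom u ds → Unique (vertices u ds) → Unique (edges ds)
  path-edges-unique []       _          _           = []
  path-edges-unique (d ∷ ds) (refl , w) (src∉ ∷ ds!) =
    All.tabulate edge-fresh ∷ path-edges-unique ds w ds!
    where
      edge-fresh : ∀ {e} → e ∈ edges ds → proj₁ d ≢ e
      edge-fresh e∈ e≡ with ∈-map⁻ proj₁ e∈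
      ... | d′ , d′∈ds , refl with walk-∈ ds w d′∈ds | same-edge⇒src-shared d d′ e≡
      ... | src′∈ , _ | inj₁ eq = All.lookup src∉ src′∈ eq
      ... | _ , dst′∈ | inj₂ eq = All.lookup src∉ dst′∈ eq

  same-vertices⇒same-edges : ∀ {u} ds ds′ → WalkFrom u ds → WalkFrom u ds′ →
    map dst ds ≡ map dst ds′ → edges ds ≡ edges ds′
  same-vertices⇒same-edges []       []         _          _            _  = refl
  same-vertices⇒same-edges (d ∷ ds) (d′ ∷ ds′) (refl , w) (src≡ , w′) eq with ∷-injective eq
  ... | dst≡ , eq′ = cong₂ _∷_ (same-ends⇒same-edge d d′ (sym src≡) dst≡)
                       (same-vertices⇒same-edges ds ds′ w (subst (λ v → WalkFrom v ds′) (sym dst≡) w′) eq′)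

  Linked⇒walk : ∀ {keep u} P → Linked (Adj G keep) (u ∷ P) →
    Σ (List Dart) λ ds → WalkFrom u ds × map dst ds ≡ P × All (λ d → keep (proj₁ d) ≡ true) ds
  Linked⇒walk []      _          = [] , tt , refl , []
  Linked⇒walk (x ∷ P) (adj ∷ rest) with Adj⇒dart adj | Linked⇒walk P rest
  ... | d , kept , src≡ , refl | ds , w , refl , kept* = d ∷ ds , (src≡ , w) , refl , kept ∷ kept*

  closedWalk⇒cycle : ∀ x cs → 2 ≤ length cs → Unique (x ∷ cs) → Linked Adjacent (x ∷ cs ∷ʳ x) →
    CycleOfLength G allEdges (suc (length cs))
  closedWalk⇒cycle x cs 2≤|cs| x∷cs! closed with Linked-lookup x cs closed
  ... | steps , closing = s≤s 2≤|cs| , lookup (x ∷ cs) , Unique⇒lookup-injective x∷cs! , steps , closing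

  prefix-path : ∀ {u} as z rs → Unique (u ∷ as ++ z ∷ rs) → Linked Adjacent (u ∷ as ++ z ∷ rs) →
    Unique (u ∷ as ∷ʳ z) × Linked Adjacent (u ∷ as ∷ʳ z)
  prefix-path {u} as z rs path! path~ =
    Unique-++⁻ˡ (u ∷ as ∷ʳ z) (subst Unique split path!) ,
    Linked-++⁻ˡ (u ∷ as ∷ʳ z) (subst (Linked Adjacent) split path~)
    where
      split : u ∷ as ++ z ∷ rs ≡ (u ∷ as ∷ʳ z) ++ rs
      split = cong (u ∷_) (sym (++-assoc as [ z ] rs))

  -- The closed walk goes out along bs to z and back along as reversed; it repeats no vertex because
  -- as avoids bs ∷ʳ z.
  twoPaths⇒cycle : ∀ {u z} as bs → Unique (u ∷ as ∷ʳ z) → Unique (u ∷ bs ∷ʳ z) →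
    Linked Adjacent (u ∷ as ∷ʳ z) → Linked Adjacent (u ∷ bs ∷ʳ z) →
    All (_∉ bs ∷ʳ z) as → 1 ≤ length as + length bs →
    CycleOfLength G allEdges (suc (length as) + suc (length bs))
  twoPaths⇒cycle {u} {z} as bs (u∉as ∷ as!) ubs! as~ bs~ as∉bsz nonempty =
    subst (CycleOfLength G allEdges) |cycle| (closedWalk⇒cycle u cs 2≤|cs| cs! closed)
    where
      cs = bs ++ z ∷ reverse as

      back : Linked Adjacent (z ∷ reverse as ∷ʳ u)
      back = subst (Linked Adjacent) (cong (z ∷_) (unfold-reverse u as))
               (subst (Linked Adjacent) (reverse-++ (u ∷ as) [ z ]) (Linked-reverse Adj-sym as~))

      closed : Linked Adjacent (u ∷ cs ∷ʳ u)
      closed = subst (Linked Adjacent) (cong (u ∷_) (sym (++-assoc bs (z ∷ reverse as) [ u ])))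
                 (Linked-join (u ∷ bs) bs~ back)

      disjoint : ∀ {v} → v ∈ u ∷ bs ∷ʳ z → v ∈ reverse as → ⊥
      disjoint v∈ v∈rev with Any.reverse⁻ v∈rev | v∈
      ... | v∈as | here refl   = All.lookup u∉as (∈-++⁺ˡ v∈as) refl
      ... | v∈as | there v∈bsz = All.lookup as∉bsz v∈as v∈bsz

      cs! : Unique (u ∷ cs)
      cs! = subst Unique (cong (u ∷_) (++-assoc bs [ z ] (reverse as)))
              (Unique.++⁺ ubs! (Unique-reverse (Unique-++⁻ˡ as as!)) (λ (p , q) → disjoint p q))

      |cycle| : suc (length cs) ≡ suc (length as) + suc (length bs)
      |cycle| = begin
        suc (length (bs ++ z ∷ reverse as))          ≡⟨ cong suc (length-++ bs) ⟩
        suc (length bs) + suc (length (reverse as))  ≡⟨ cong (λ k → suc (length bs) + suc k) (length-reverse as) ⟩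
        suc (length bs) + suc (length as)            ≡⟨ ℕP.+-comm (suc (length bs)) (suc (length as)) ⟩
        suc (length as) + suc (length bs)            ∎
        where open ≡-Reasoning

      2≤|cs| : 2 ≤ length cs
      2≤|cs| = subst (2 ≤_) (sym (trans (ℕP.suc-injective |cycle|) (ℕP.+-suc (length as) (length bs))))
                 (s≤s nonempty)

  -- z is the first vertex of x ∷ P lying on y ∷ Q; one exists because the two paths end at the same vertex.
  diverging-paths⇒cycle : ∀ {u x y} P Q → x ≢ y →
    Unique (u ∷ x ∷ P) → Unique (u ∷ y ∷ Q) → Linked Adjacent (u ∷ x ∷ P) → Linked Adjacent (u ∷ y ∷ Q) →
    lastOr x P ≡ lastOr y Q →
    Σ ℕ λ k → k ≤ suc (length P) + suc (length Q) × CycleOfLength G allEdges k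
  diverging-paths⇒cycle {u} {x} {y} P Q x≢y P! Q! P~ Q~ same-end
    with splitAtFirstIn _≟_ (x ∷ P) (y ∷ Q)
           (lose (lastOr-∈ x P) (subst (_∈ y ∷ Q) (sym same-end) (lastOr-∈ y Q)))
  ... | as , z , rs , P≡ , as∉Q , z∈Q with ∈-∃++ z∈Q
  ... | bs , rs′ , Q≡ =
    _ , ℕP.+-mono-≤ (prefix-length P≡) (prefix-length Q≡) ,
    twoPaths⇒cycle as bs (proj₁ as-prefix) (proj₁ bs-prefix) (proj₂ as-prefix) (proj₂ bs-prefix)
      as∉bsz (distinct-heads⇒nonempty-prefix as bs P≡ Q≡ x≢y)
    where
      prefix-length : ∀ {L as z rs} → L ≡ as ++ z ∷ rs → suc (length as) ≤ length L
      prefix-length {as = as} {z} {rs} refl = length-++-∷ as z rs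
      as-prefix : Unique (u ∷ as ∷ʳ z) × Linked Adjacent (u ∷ as ∷ʳ z)
      as-prefix = prefix-path as z rs (subst (λ L → Unique (u ∷ L)) P≡ P!)
                    (subst (λ L → Linked Adjacent (u ∷ L)) P≡ P~)
      bs-prefix : Unique (u ∷ bs ∷ʳ z) × Linked Adjacent (u ∷ bs ∷ʳ z)
      bs-prefix = prefix-path bs z rs′ (subst (λ L → Unique (u ∷ L)) Q≡ Q!)
                    (subst (λ L → Linked Adjacent (u ∷ L)) Q≡ Q~)
      as∉bsz : All (_∉ bs ∷ʳ z) as
      as∉bsz = All.map (λ v∉Q v∈ → v∉Q (subst (_ ∈_) (sym Q≡) (subst (_ ∈_) (++-assoc bs [ z ] rs′) (∈-++⁺ˡ v∈))))
                 as∉Q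

  record IsPath (h : ℕ) (u v : Fin n) (ds : List Dart) : Set where
    field
      walk     : WalkFrom u ds
      distinct : Unique (vertices u ds)
      ends-at  : lastOr u (map dst ds) ≡ v
      length≡  : length ds ≡ h

  open IsPath

  isPath? : ∀ h u v ds → Dec (IsPath h u v ds)
  isPath? h u v ds =
    map′ (λ (w , d , e , l) → record { walk = w ; distinct = d ; ends-at = e ; length≡ = l })
         (λ p → walk p , distinct p , ends-at p , length≡ p)
         (walkFrom? u ds ×-dec unique? (vertices u ds) ×-dec lastOr u (map dst ds) ≟ v ×-dec length ds ℕ.≟ h)

  module _ {ℓ : ℕ} (noShortCycle : ∀ k → k < ℓ → ¬ CycleOfLength G allEdges k) where

    short-paths-unique : ∀ u P Q → Unique (u ∷ P) → Unique (u ∷ Q) →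
      Linked Adjacent (u ∷ P) → Linked Adjacent (u ∷ Q) →
      lastOr u P ≡ lastOr u Q → length P + length Q < ℓ → P ≡ Q
    short-paths-unique u []      []      _          _          _  _  _        _ = refl
    short-paths-unique u []      (y ∷ Q) _          (u∉Q ∷ _) _  _  same-end _ =
      ⊥-elim (All.lookup u∉Q (lastOr-∈ y Q) same-end)
    short-paths-unique u (x ∷ P) []      (u∉P ∷ _) _          _  _  same-end _ =
      ⊥-elim (All.lookup u∉P (lastOr-∈ x P) (sym same-end))
    short-paths-unique u (x ∷ P) (y ∷ Q) P! Q! P~ Q~ same-end short with x ≟ y
    ... | no x≢y with diverging-paths⇒cycle P Q x≢y P! Q! P~ Q~ same-end
    ...   | k , k≤ , cycle = ⊥-elim (noShortCycle k (ℕP.≤-<-trans k≤ short) cycle)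
    short-paths-unique u (x ∷ P) (x ∷ Q) (_ ∷ P!) (_ ∷ Q!) P~ Q~ same-end short | yes refl =
      cong (x ∷_) (short-paths-unique x P Q P! Q! (Linked.tail P~) (Linked.tail Q~) same-end
        (ℕP.<-trans (ℕP.+-mono-< (ℕP.n<1+n (length P)) (ℕP.n<1+n (length Q))) short))

    paths-unique : ∀ {h u v ds ds′} → h + h < ℓ → IsPath h u v ds → IsPath h u v ds′ → edges ds ≡ edges ds′
    paths-unique {h} {u} {ds = ds} {ds′} short p p′ =
      same-vertices⇒same-edges ds ds′ (walk p) (walk p′)
        (short-paths-unique u (map dst ds) (map dst ds′) (distinct p) (distinct p′)
          (walk-linked ds (walk p)) (walk-linked ds′ (walk p′)) (trans (ends-at p) (sym (ends-at p′)))
          (subst₂ (λ a b → a + b < ℓ) (sym (|dsts| p)) (sym (|dsts| p′)) short))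
      where
        |dsts| : ∀ {v ds} → IsPath h u v ds → length (map dst ds) ≡ h
        |dsts| {ds = ds} p = trans (length-map dst ds) (length≡ p)

  cycle⇒path : ∀ {keep k h} → h ≤ k → CycleOfLength G keep (suc k) →
    Σ (Fin n) λ u → Σ (List Dart) λ ds →
      IsPath h u (lastOr u (map dst ds)) ds × All (λ d → keep (proj₁ d) ≡ true) ds
  cycle⇒path {keep} {k} {h} h≤k (_ , v , v-injective , steps , _)
    with Linked⇒walk (take h (tabulate (λ i → v (suc i)))) (Linked-take (suc h) (Linked-tabulate v steps))
  ... | ds , w , dsts≡ , kept = v zero , ds , path , kept
    where
      path : IsPath h (v zero) (lastOr (v zero) (map dst ds)) ds
      path .walk     = w
      path .distinct = subst (λ P → Unique (v zero ∷ P)) (sym dsts≡)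
                         (Unique.take⁺ (suc h) (Unique.tabulate⁺ v-injective))
      path .ends-at  = refl
      path .length≡  = begin
        length ds                                    ≡⟨ length-map dst ds ⟨
        length (map dst ds)                          ≡⟨ cong length dsts≡ ⟩
        length (take h (tabulate (λ i → v (suc i)))) ≡⟨ length-take h _ ⟩
        h ℕ.⊓ length (tabulate (λ i → v (suc i)))    ≡⟨ cong (h ℕ.⊓_) (length-tabulate _) ⟩
        h ℕ.⊓ k                                      ≡⟨ ℕP.m≤n⇒m⊓n≡m h≤k ⟩
        h                                            ∎
        where open ≡-Reasoning

  allDarts : List Dart
  allDarts = cartesianProduct (allFin m) (true ∷ false ∷ [])

  ∈-allDarts : ∀ d → d ∈ allDarts
  ∈-allDarts (e , b) = ∈-cartesianProduct⁺ (∈-allFin e) (bool∈ b)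
    where
      bool∈ : ∀ b → b ∈ true ∷ false ∷ []
      bool∈ true  = here refl
      bool∈ false = there (here refl)

  -- Restricting to ends of darts keeps the number of candidate pairs at (2m)², independently of n.
  endpointPairs : List (Fin n × Fin n)
  endpointPairs = cartesianProduct (map src allDarts) (map dst allDarts)

  length-endpointPairs : length endpointPairs ≡ (m ℕ.* 2) ℕ.* (m ℕ.* 2)
  length-endpointPairs = trans (length-cartesianProduct (map src allDarts) (map dst allDarts))
    (cong₂ ℕ._*_ (trans (length-map src allDarts) |allDarts|) (trans (length-map dst allDarts) |allDarts|))
    where
      |allDarts| : length allDarts ≡ m ℕ.* 2
      |allDarts| = trans (length-cartesianProduct (allFin m) (true ∷ false ∷ []))
                     (cong (ℕ._* 2) (length-tabulate {n = m} (λ i → i)))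

  ends∈endpointPairs : ∀ {u} d ds → WalkFrom u (d ∷ ds) → (u , lastOr u (map dst (d ∷ ds))) ∈ endpointPairs
  ends∈endpointPairs d ds (refl , _) =
    ∈-cartesianProduct⁺ (∈-map⁺ src (∈-allDarts d)) (end∈ (lastOr-∈ (dst d) (map dst ds)))
    where
      end∈ : ∀ {v} → v ∈ map dst (d ∷ ds) → v ∈ map dst allDarts
      end∈ v∈ with ∈-map⁻ dst {xs = d ∷ ds} v∈
      ... | d′ , _ , refl = ∈-map⁺ dst (∈-allDarts d′)

  module _ (h : ℕ) where

    canonicalPath : (u v : Fin n) → Maybe (∃ (IsPath h u v))
    canonicalPath u v with Any.any? (isPath? h u v) (listsOfLength allDarts h)
    ... | yes found = just (Any.satisfied found)
    ... | no  _     = nothing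

    canonicalPath-complete : ∀ {u v ds} → IsPath h u v ds → Σ (∃ (IsPath h u v)) λ p → canonicalPath u v ≡ just p
    canonicalPath-complete {u} {v} {ds} p with Any.any? (isPath? h u v) (listsOfLength allDarts h)
    ... | yes found = Any.satisfied found , refl
    ... | no  none  = ⊥-elim (none (lose ds∈ p))
      where
        ds∈ : ds ∈ listsOfLength allDarts h
        ds∈ = subst (λ k → ds ∈ listsOfLength allDarts k) (length≡ p)
                (∈-listsOfLength (All.tabulate (λ {d} _ → ∈-allDarts d)))

module SampledPaths {n m s : ℕ} (G : Graph n m) where

  open ListFacts
  open RationalArithmetic
  open Probability {m} {s}
  open Paths G
  open IsPath
  open import Data.Bool using (Bool; true; false; T)
  open import Data.Bool.Properties using (T-≡)
  open import Function.Bundles using (Equivalence)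
  open import Data.Bool.ListAction using (any)
  open import Data.Nat as ℕ using (zero; suc; _+_; _*_; _^_; _≤_; _<_; s≤s)
  import Data.Nat.Properties as ℕP
  open import Data.Fin using (Fin; zero; suc)
  open import Data.List using (List; []; _∷_; length; map; allFin; cartesianProduct)
  open import Data.List.Properties using (length-map; length-tabulate)
  open import Data.List.Relation.Unary.All as All using (All)
  import Data.List.Relation.Unary.All.Properties as All
  import Data.List.Relation.Unary.Any.Properties as Any
  import Data.List.Relation.Unary.Unique.Propositional.Properties as Unique
  open import Data.List.Relation.Unary.Unique.Propositional using (Unique)
  open import Data.List.Membership.Propositional using (lose)
  open import Data.Maybe using (Maybe; just; nothing)
  open import Data.Product using (∃; _×_; _,_; proj₁; proj₂)
  import Data.Rational as ℚ
  import Data.Rational.Properties as ℚP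
  open import Data.Empty using (⊥-elim)
  open import Relation.Binary.PropositionalEquality
  open import Relation.Nullary using (¬_)

  edgeBits : List (Fin m) → List (Fin m × Fin s)
  edgeBits es = cartesianProduct es (allFin s)

  length-edgeBits : ∀ es → length (edgeBits es) ≡ length es * s
  length-edgeBits es =
    trans (length-cartesianProduct es (allFin s)) (cong (length es *_) (length-tabulate {n = s} (λ j → j)))

  edgeBits-unique : ∀ {es} → Unique es → Unique (edgeBits es)
  edgeBits-unique es! = Unique.cartesianProduct⁺ es! (Unique.allFin⁺ s)

  andAll-true : ∀ k (f : Fin k → Bool) → andAll k f ≡ true → ∀ j → f j ≡ true
  andAll-true (suc k) f f≡1 zero    with f zero
  ... | true = refl
  andAll-true (suc k) f f≡1 (suc j) with f zero
  ... | true = andAll-true k (λ i → f (suc i)) f≡1 j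

  allOnes-edgeBits : ∀ {Y} es → All (λ e → sampled Y e ≡ true) es → allOnes (edgeBits es) Y ≡ true
  allOnes-edgeBits {Y} es sampled-es = allOnes-true (edgeBits es)
    (All.cartesianProduct⁺ (setoid _) (setoid _) es (allFin s)
      (λ e∈ _ → andAll-true s (Y _) (All.lookup sampled-es e∈) _))

  sampledAlong : ∀ {h u v} → Maybe (∃ (IsPath h u v)) → Event
  sampledAlong nothing          _ = false
  sampledAlong (just (ds , _)) Y = allOnes (edgeBits (edges ds)) Y

  sampledBetween : ℕ → Fin n × Fin n → Event
  sampledBetween h (u , v) = sampledAlong (canonicalPath h u v)

  someShortPathSampled : ℕ → Event
  someShortPathSampled h Y = any (λ uv → sampledBetween h uv Y) endpointPairs

  module _ {ℓ h : ℕ} (noShortCycle : ∀ k → k < ℓ → ¬ CycleOfLength G allEdges k)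
           (1≤h : 1 ≤ h) (2h<ℓ : h + h < ℓ) where

    cycle⇒someShortPathSampled : ∀ {Y k} → CycleOfLength G (sampled Y) k → T (someShortPathSampled h Y)
    cycle⇒someShortPathSampled {Y} {suc k} cycle with cycle⇒path h≤k cycle
      where
        h≤k : h ≤ k
        h≤k = ℕP.≤-pred (ℕP.≤-trans (s≤s (ℕP.m≤m+n h h))
                (ℕP.≤-trans 2h<ℓ (ℕP.≮⇒≥ (λ short → noShortCycle (suc k) short (subgraph-cycle cycle)))))
    ... | u , [] , p , _ = ⊥-elim (ℕP.<⇒≱ 1≤h (ℕP.≤-reflexive (sym (length≡ p))))
    ... | u , d ∷ ds , p , kept with canonicalPath-complete h p
    ...   | (ds′ , p′) , found =
      Any.any⁺ _ (lose (ends∈endpointPairs d ds (walk p)) (Equivalence.from T-≡ path-sampled))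
      where
        path-sampled : sampledBetween h (u , lastOr u (map dst (d ∷ ds))) Y ≡ true
        path-sampled rewrite found =
          subst (λ es → allOnes (edgeBits es) Y ≡ true) (sym (paths-unique noShortCycle 2h<ℓ p′ p))
            (allOnes-edgeBits (edges (d ∷ ds)) (All.map⁺ kept))

  module _ {D : Dist m s} (0≤D : AllNonNeg (map proj₁ D)) {M K : ℕ} (almost : AlmostKWiseInv D M K)
           {h : ℕ} (hs≤K : h * s ≤ K) (2^hs≤M : 2 ^ (h * s) ≤ M) where

    Pr-sampledAlong : ∀ {u v} (c : Maybe (∃ (IsPath h u v))) →
      Pr D (sampledAlong c) ℚ.* ℕtoℚ (2 ^ (h * s)) ℚ.≤ ℕtoℚ 3
    Pr-sampledAlong nothing =
      ℚP.≤-trans (ℚP.≤-reflexive (trans (cong (ℚ._* X) (Pr-never D)) (ℚP.*-zeroˡ X))) (0≤ℕtoℚ 3)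
      where X = ℕtoℚ (2 ^ (h * s))
    Pr-sampledAlong (just (ds , p)) =
      subst (λ k → Pr D (allOnes S) ℚ.* ℕtoℚ (2 ^ k) ℚ.≤ ℕtoℚ 3) |S|
        (Pr-allOnes-bound D S (almost S S! (subst (_≤ K) (sym |S|) hs≤K))
          (subst (λ k → 2 ^ k ≤ M) (sym |S|) 2^hs≤M))
      where
        S : List (Fin m × Fin s)
        S = edgeBits (edges ds)
        S! : Unique S
        S! = edgeBits-unique (path-edges-unique ds (walk p) (distinct p))
        |S| : length S ≡ h * s
        |S| = trans (length-edgeBits (edges ds)) (cong (_* s) (trans (length-map proj₁ ds) (length≡ p)))

    Pr-sampledBetween : ∀ uv → Pr D (sampledBetween h uv) ℚ.* ℕtoℚ (2 ^ (h * s)) ℚ.≤ ℕtoℚ 3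
    Pr-sampledBetween (u , v) = Pr-sampledAlong (canonicalPath h u v)

    Pr-someShortPathSampled :
      Pr D (someShortPathSampled h) ℚ.* ℕtoℚ (2 ^ (h * s)) ℚ.≤ ℕtoℚ ((m * 2) * (m * 2) * 3)
    Pr-someShortPathSampled =
      subst (λ N → Pr D (someShortPathSampled h) ℚ.* ℕtoℚ (2 ^ (h * s)) ℚ.≤ ℕtoℚ (N * 3)) length-endpointPairs
        (Pr-any-bound 0≤D (sampledBetween h) (0≤ℕtoℚ (2 ^ (h * s))) endpointPairs
          (All.tabulate (λ {uv} _ → Pr-sampledBetween uv)))

open import Data.Nat using (ℕ; _≤_; _<_; _^_; _*_)
open import Data.Product using (Σ; _×_)
open import Function.Bundles using (_⇔_)

open import Data.Bool using (T)
open import Data.Nat using (zero; suc; _+_; z≤n; s≤s; ⌊_/2⌋; >-nonZero)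
import Data.Nat.Properties as ℕP
open import Data.Nat.Solver using (module +-*-Solver)
open import Data.List using (lookup)
open import Data.Product using (_,_; proj₂)
open import Data.Empty using (⊥-elim)
open import Function.Bundles using (Equivalence)
import Data.Rational as ℚ
import Data.Rational.Properties as ℚP
open import Relation.Binary.PropositionalEquality
open RationalArithmetic using (p*x≤c∧c*a≤x⇒p*a≤1)
open ℕP.≤-Reasoning

⌊n/2⌋+⌊n/2⌋≤n : ∀ n → ⌊ n /2⌋ + ⌊ n /2⌋ ≤ n
⌊n/2⌋+⌊n/2⌋≤n zero          = z≤n
⌊n/2⌋+⌊n/2⌋≤n (suc zero)    = z≤n
⌊n/2⌋+⌊n/2⌋≤n (suc (suc n)) rewrite ℕP.+-suc ⌊ n /2⌋ ⌊ n /2⌋ = s≤s (s≤s (⌊n/2⌋+⌊n/2⌋≤n n))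

n≤1+⌊n/2⌋+⌊n/2⌋ : ∀ n → n ≤ suc (⌊ n /2⌋ + ⌊ n /2⌋)
n≤1+⌊n/2⌋+⌊n/2⌋ zero          = z≤n
n≤1+⌊n/2⌋+⌊n/2⌋ (suc zero)    = s≤s z≤n
n≤1+⌊n/2⌋+⌊n/2⌋ (suc (suc n)) rewrite ℕP.+-suc ⌊ n /2⌋ ⌊ n /2⌋ = s≤s (s≤s (n≤1+⌊n/2⌋+⌊n/2⌋ n))

1+n≤4⌊n/2⌋ : ∀ n → 2 ≤ n → suc n ≤ 4 * ⌊ n /2⌋
1+n≤4⌊n/2⌋ n 2≤n = begin
  suc n                                     ≤⟨ s≤s (n≤1+⌊n/2⌋+⌊n/2⌋ n) ⟩
  2 + (h + h)                               ≤⟨ ℕP.+-monoˡ-≤ (h + h) (ℕP.+-mono-≤ 1≤h 1≤h) ⟩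
  (h + h) + (h + h)                         ≡⟨ solve 1 (λ h → (h :+ h) :+ (h :+ h) := con 4 :* h) refl h ⟩
  4 * h                                     ∎
  where
    open +-*-Solver
    h = ⌊ n /2⌋
    1≤h : 1 ≤ h
    1≤h = ℕP.⌊n/2⌋-mono 2≤n

^-cancelˡ-≤ : ∀ k {x y} → x ^ suc k ≤ y ^ suc k → x ≤ y
^-cancelˡ-≤ k x^k≤y^k = ℕP.≮⇒≥ (λ y<x → ℕP.<⇒≱ (ℕP.^-monoˡ-< (suc k) y<x) x^k≤y^k)

2^sℓ≤m^60 : ∀ {m ℓ} s → 2 ≤ m → 2 ^ ℓ ≤ m ^ 20 → (∀ t → (m ^ 40 ≤ 2 ^ (t * ℓ)) ⇔ (s ≤ t)) →
  2 ^ (s * ℓ) ≤ m ^ 60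
2^sℓ≤m^60 zero    2≤m _ minimal = ⊥-elim (ℕP.<⇒≱ (ℕP.^-monoˡ-< 40 2≤m) (Equivalence.from (minimal 0) z≤n))
2^sℓ≤m^60 {m} {ℓ} (suc t) _ 2^ℓ≤m^20 minimal = begin
  2 ^ (ℓ + t * ℓ)      ≡⟨ ℕP.^-distribˡ-+-* 2 ℓ (t * ℓ) ⟩
  2 ^ ℓ * 2 ^ (t * ℓ)  ≤⟨ ℕP.*-mono-≤ 2^ℓ≤m^20 (ℕP.<⇒≤ 2^tℓ<m^40) ⟩
  m ^ 20 * m ^ 40      ≡⟨ ℕP.^-distribˡ-+-* m 20 40 ⟨
  m ^ 60               ∎
  where
    2^tℓ<m^40 : 2 ^ (t * ℓ) < m ^ 40
    2^tℓ<m^40 = ℕP.≰⇒> (λ m^40≤2^tℓ → ℕP.<-irrefl refl (Equivalence.to (minimal t) m^40≤2^tℓ))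

2^hs≤m^200 : ∀ {m ℓ} s {h} → 2 ≤ m → h ≤ ℓ → 2 ^ ℓ ≤ m ^ 20 → (∀ t → (m ^ 40 ≤ 2 ^ (t * ℓ)) ⇔ (s ≤ t)) →
  2 ^ (h * s) ≤ m ^ 200
2^hs≤m^200 {m} {ℓ} s {h} 2≤m h≤ℓ 2^ℓ≤m^20 minimal = begin
  2 ^ (h * s)  ≤⟨ ℕP.^-monoʳ-≤ 2 (ℕP.≤-trans (ℕP.*-monoˡ-≤ s h≤ℓ) (ℕP.≤-reflexive (ℕP.*-comm ℓ s))) ⟩
  2 ^ (s * ℓ)  ≤⟨ 2^sℓ≤m^60 s 2≤m 2^ℓ≤m^20 minimal ⟩
  m ^ 60       ≤⟨ ℕP.^-monoʳ-≤ m {{>-nonZero (ℕP.<-trans (s≤s z≤n) 2≤m)}} (ℕP.m≤m+n 60 140) ⟩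
  m ^ 200      ∎

m^10≤2^hs : ∀ m {ℓ} s h → m ^ 40 ≤ 2 ^ (s * ℓ) → ℓ ≤ 4 * h → m ^ 10 ≤ 2 ^ (h * s)
m^10≤2^hs m {ℓ} s h m^40≤2^sℓ ℓ≤4h = ^-cancelˡ-≤ 3 (begin
  (m ^ 10) ^ 4         ≡⟨ ℕP.^-*-assoc m 10 4 ⟩
  m ^ 40               ≤⟨ m^40≤2^sℓ ⟩
  2 ^ (s * ℓ)          ≤⟨ ℕP.^-monoʳ-≤ 2 (ℕP.*-monoʳ-≤ s ℓ≤4h) ⟩
  2 ^ (s * (4 * h))    ≡⟨ cong (2 ^_) (solve 2 (λ s h → s :* (con 4 :* h) := (h :* s) :* con 4) refl s h) ⟩
  2 ^ (h * s * 4)      ≡⟨ ℕP.^-*-assoc 2 (h * s) 4 ⟨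
  (2 ^ (h * s)) ^ 4    ∎)
  where open +-*-Solver

12m²·m^7≤m^10 : ∀ m → 12 ≤ m → (m * 2) * (m * 2) * 3 * m ^ 7 ≤ m ^ 10
12m²·m^7≤m^10 m 12≤m = begin
  (m * 2) * (m * 2) * 3 * m ^ 7  ≡⟨ solve 1 (λ m → (m :* con 2) :* (m :* con 2) :* con 3 :* m :^ 7
                                              := con 12 :* m :^ 9) refl m ⟩
  12 * m ^ 9                     ≤⟨ ℕP.*-monoˡ-≤ (m ^ 9) 12≤m ⟩
  m ^ 10                         ∎
  where open +-*-Solver

corollary4p3 :
    Σ ℕ λ a → Σ ℕ λ b → 1 ≤ a × 1 ≤ b × Σ ℕ λ m₀ →
      ∀ (m : ℕ) → m₀ ≤ m →
      ∀ (n : ℕ) (G : Graph n m) (ℓ : ℕ) → Girth G ℓ →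
      2 ^ ℓ ≤ m ^ 20 →
      ∀ (s : ℕ) → (∀ t → (m ^ 40 ≤ 2 ^ (t * ℓ)) ⇔ (s ≤ t)) →
      ∀ (D : Dist m s) → IsDist D → AlmostKWiseInv D (m ^ 200) (ℓ * s) →
      FailProbAtMost G D a b
corollary4p3 = 7 , 1 , s≤s z≤n , s≤s z≤n , 12 , bound
  where
  bound : ∀ m → 12 ≤ m → ∀ n (G : Graph n m) ℓ → Girth G ℓ → 2 ^ ℓ ≤ m ^ 20 →
    ∀ s → (∀ t → (m ^ 40 ≤ 2 ^ (t * ℓ)) ⇔ (s ≤ t)) →
    ∀ (D : Dist m s) → IsDist D → AlmostKWiseInv D (m ^ 200) (ℓ * s) → FailProbAtMost G D 7 1
  bound m 12≤m n G zero    (() , _)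
  bound m 12≤m n G (suc L) ((3≤ℓ , _) , noShortCycle) 2^ℓ≤m^20 s minimal D (0≤D , _) almost =
    (λ i → someShortPathSampled h (proj₂ (lookup D i))) ,
    (λ i unsampled _ cycle → subst T unsampled (cycle⇒someShortPathSampled noShortCycle 1≤h 2h<ℓ cycle)) ,
    subst (λ W → W ℚ.* ℕtoℚ (m ^ 7) ℚ.≤ ℚ.1ℚ) (sym (ℚP.*-identityʳ (Pr D (someShortPathSampled h))))
      (p*x≤c∧c*a≤x⇒p*a≤1 {Pr D (someShortPathSampled h)} {2 ^ (h * s)} {(m * 2) * (m * 2) * 3} {m ^ 7}
        (Pr-someShortPathSampled 0≤D almost {h} (ℕP.*-monoˡ-≤ s h≤ℓ)
          (2^hs≤m^200 s 2≤m h≤ℓ 2^ℓ≤m^20 minimal))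
        (ℕP.≤-trans (12m²·m^7≤m^10 m 12≤m)
          (m^10≤2^hs m s h (Equivalence.from (minimal s) ℕP.≤-refl) (1+n≤4⌊n/2⌋ L (ℕP.≤-pred 3≤ℓ))))
        (ℕP.m^n>0 2 (h * s)))
    where
      open SampledPaths {s = s} G
      open Probability {m} {s} using (Pr)
      h : ℕ
      h = ⌊ L /2⌋
      2≤m : 2 ≤ m
      2≤m = ℕP.≤-trans (s≤s (s≤s z≤n)) 12≤m
      1≤h : 1 ≤ h
      1≤h = ℕP.⌊n/2⌋-mono (ℕP.≤-pred 3≤ℓ)
      2h<ℓ : h + h < suc L
      2h<ℓ = s≤s (⌊n/2⌋+⌊n/2⌋≤n L)
      h≤ℓ : h ≤ suc L
      h≤ℓ = ℕP.m≤n⇒m≤1+n (ℕP.⌊n/2⌋≤n L)
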